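{- Let $G$ be a connected graph of order $n\ge 2$. Then \[ AG(G)\le \frac{n^2}{4(n-1)}\,GA(G), \] with equality if and only if $G$ is isomorphic to $K_{1,n-1}$.
   Context: All graphs are finite, simple and undirected. $d_i$ is the degree of vertex $v_i$; $i\sim j$ denotes an edge $v_iv_j$ and sums over $i\sim j$ run over edges, each once. $AG(G)=\sum_{i\sim j}\frac12\left(\sqrt{d_i/d_j}+\sqrt{d_j/d_i}\right)$ and $GA(G)=\sum_{i\sim j}\frac{2\sqrt{d_id_j}}{d_i+d_j}$. -}

module Defs where

open import Level using (Level; 0ℓ)
open import Data.Nat as ℕ using (ℕ; zero; suc; _<ᵇ_)
open import Data.Fin using (Fin; toℕ)
open import Data.Fin as Fin using ()
open import Data.List using (List; foldr; map)
open import Data.List.Base using ()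
open import Data.Fin.Base using ()
open import Data.List using () renaming (allFin to allFinL)
open import Data.Bool using (Bool; true; false; if_then_else_; _∧_; _xor_)
open import Data.Product using (Σ; ∃; _×_; _,_)
open import Relation.Binary.PropositionalEquality using (_≡_; _≢_)
open import Relation.Binary.Structures using (IsTotalOrder)
open import Algebra.Structures using (IsCommutativeRing)
open import Function.Bundles using (_↔_; Inverse)

-- A model of the real numbers: a Dedekind-complete ordered field
-- (unique up to isomorphism), equipped with the (nonnegative) square
-- root on nonnegative elements.

record RealField : Set₁ where
  infixl 6 _+_
  infixl 7 _*_
  field
    Carrier : Set
    _+_ _*_ : Carrier → Carrier → Carrier
    -_      : Carrier → Carrier
    0r 1r   : Carrier
    _⁻¹     : Carrier → Carrier
    _≤_     : Carrier → Carrier → Set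
    isCommutativeRing : IsCommutativeRing _≡_ _+_ _*_ -_ 0r 1r
    0≢1     : 0r ≢ 1r
    inverseʳ : ∀ x → x ≢ 0r → x * (x ⁻¹) ≡ 1r
    isTotalOrder : IsTotalOrder _≡_ _≤_
    +-mono-≤ : ∀ x y z → x ≤ y → (x + z) ≤ (y + z)
    *-nonneg : ∀ x y → 0r ≤ x → 0r ≤ y → 0r ≤ (x * y)
    sup : (P : Carrier → Set) → ∃ P → (∃ λ b → ∀ x → P x → x ≤ b) →
          ∃ λ s → (∀ x → P x → x ≤ s) × (∀ b → (∀ x → P x → x ≤ b) → s ≤ b)
    √_       : Carrier → Carrier
    √-nonneg : ∀ x → 0r ≤ x → 0r ≤ (√ x)
    √-sq     : ∀ x → 0r ≤ x → (√ x) * (√ x) ≡ x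

record Graph (n : ℕ) : Set where
  field
    adj     : Fin n → Fin n → Bool
    adj-sym : ∀ i j → adj i j ≡ adj j i
    adj-irr : ∀ i → adj i i ≡ false
open Graph public

sumFin : {A : Set} → (A → A → A) → A → (n : ℕ) → (Fin n → A) → A
sumFin _⊕_ e n f = foldr (λ i acc → f i ⊕ acc) e (allFinL n)

degree : {n : ℕ} → Graph n → Fin n → ℕ
degree {n} G i = sumFin ℕ._+_ 0 n (λ j → if adj G i j then 1 else 0)

data Reachable {n : ℕ} (G : Graph n) : Fin n → Fin n → Set where
  here : ∀ {i} → Reachable G i i
  step : ∀ {i k j} → adj G i k ≡ true → Reachable G k j → Reachable G i j

Connected : {n : ℕ} → Graph n → Set
Connected {n} G = ∀ (i j : Fin n) → Reachable G i j

_≅_ : {n m : ℕ} → Graph n → Graph m → Set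
_≅_ {n} {m} G H = Σ (Fin n ↔ Fin m) λ f →
  ∀ i j → adj G i j ≡ adj H (Inverse.to f i) (Inverse.to f j)

isZero : {n : ℕ} → Fin n → Bool
isZero Fin.zero    = true
isZero (Fin.suc _) = false

star : (n : ℕ) → Graph n
star n = record { adj = λ i j → isZero i xor isZero j
                ; adj-sym = sym′ ; adj-irr = irr }
  where
  sym′ : ∀ (i j : Fin n) → (isZero i xor isZero j) ≡ (isZero j xor isZero i)
  sym′ i j with isZero i | isZero j
  ... | true  | true  = Relation.Binary.PropositionalEquality.refl
  ... | true  | false = Relation.Binary.PropositionalEquality.refl
  ... | false | true  = Relation.Binary.PropositionalEquality.refl
  ... | false | false = Relation.Binary.PropositionalEquality.refl
  irr : ∀ (i : Fin n) → (isZero i xor isZero i) ≡ false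
  irr i with isZero i
  ... | true  = Relation.Binary.PropositionalEquality.refl
  ... | false = Relation.Binary.PropositionalEquality.refl

module Indices (R : RealField) where
  open RealField R

  fromℕ : ℕ → Carrier
  fromℕ zero    = 0r
  fromℕ (suc k) = 1r + fromℕ k

  _/_ : Carrier → Carrier → Carrier
  x / y = x * (y ⁻¹)

  edgeSum : {n : ℕ} → Graph n → (Fin n → Fin n → Carrier) → Carrier
  edgeSum {n} G f = sumFin _+_ 0r n λ i → sumFin _+_ 0r n λ j →
    if (toℕ i <ᵇ toℕ j) ∧ adj G i j then f i j else 0r

  AG : {n : ℕ} → Graph n → Carrier
  AG G = edgeSum G λ i j →
    let di = fromℕ (degree G i) ; dj = fromℕ (degree G j) in
    (1r / (1r + 1r)) * ((√ (di / dj)) + (√ (dj / di)))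

  GA : {n : ℕ} → Graph n → Carrier
  GA G = edgeSum G λ i j →
    let di = fromℕ (degree G i) ; dj = fromℕ (degree G j) in
    ((1r + 1r) * (√ (di * dj))) / (di + dj)

-- On an edge whose end degrees are a and b, the AG term is (a + b)/(2√(ab)) and the GA term is
-- 2√(ab)/(a + b), so their ratio is (a + b)²/(4ab).  If a, b ≤ m = n − 1 then
-- ab(m + 1)² − m(a + b)² = (ma − b)(mb − a) ≥ 0, so the ratio is at most n²/(4(n − 1)), with equality
-- exactly when {a, b} = {1, m}.  Summing over the edges gives the inequality; equality forces every
-- edge to join a leaf to a vertex adjacent to all others, and a connected graph with that property
-- is the star K_{1,n−1}.
module Submission where

open import Defs
open import Data.Nat as ℕ using (ℕ; zero; suc)
import Data.Nat.Properties as ℕ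
open import Data.Product using (∃; _×_; _,_; proj₁; proj₂)
open import Data.Sum using (_⊎_; inj₁; inj₂)
open import Data.Empty using (⊥-elim)
open import Data.Bool using (Bool; true; false; if_then_else_; _xor_; _∧_; T)
open import Data.Fin as Fin using (Fin; zero; suc; punchIn; punchOut; _≟_; toℕ)
import Data.Fin.Properties as Fin
open import Data.Fin.Permutation using (transpose)
import Data.Fin.Permutation.Components as PC
open import Data.List using (foldr; tabulate; _∷_; [])
open import Function using (_∘_; id; Injective; Inverse; Injection)
open import Function.Properties.Inverse using (↔⇒↣)
open import Relation.Binary.PropositionalEquality
open import Relation.Nullary using (¬_; yes; no)
open import Relation.Nullary.Decidable using (does; dec-true; dec-false)
open import Level using (0ℓ)
open import Algebra.Bundles using (CommutativeRing)
open import Relation.Binary.Structures using (IsTotalOrder)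
open import Relation.Binary.Definitions using (tri<; tri≈; tri>)

module StarEdgeArithmetic where
  open import Data.Nat using (_+_; _*_; _≤_)
  open import Data.Nat.Tactic.RingSolver using (solve)

  StarDegrees : ℕ → ℕ → ℕ → Set
  StarDegrees m a b = (a ≡ 1 × b ≡ m) ⊎ (a ≡ m × b ≡ 1)

  StarDegrees-sym : ∀ {m a b} → StarDegrees m a b → StarDegrees m b a
  StarDegrees-sym (inj₁ (a≡1 , b≡m)) = inj₂ (b≡m , a≡1)
  StarDegrees-sym (inj₂ (a≡m , b≡1)) = inj₁ (b≡1 , a≡m)

  -- With x = m a − b and y = m b − a this says a b (m + 1)² − m (a + b)² = (m a − b)(m b − a),
  -- stated without truncated subtraction.
  cross-gap-identity : ∀ m a b x y → b + x ≡ m * a → a + y ≡ m * b →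
                       a * b * (suc m * suc m) ≡ m * ((a + b) * (a + b)) + x * y
  cross-gap-identity m a b x y b+x≡ma a+y≡mb = begin
    a * b * (suc m * suc m)
      ≡⟨ solve (m ∷ a ∷ b ∷ []) ⟩
    (m * a) * (m * b) + 2 * ((m * a) * b) + a * b
      ≡⟨ cong₂ (λ p q → p * q + 2 * (p * b) + a * b) (sym b+x≡ma) (sym a+y≡mb) ⟩
    (b + x) * (a + y) + 2 * ((b + x) * b) + a * b
      ≡⟨ solve (a ∷ b ∷ x ∷ y ∷ []) ⟩
    a * (b + x) + b * (a + y) + 2 * ((b + x) * b) + x * y
      ≡⟨ cong₂ (λ p q → a * p + b * q + 2 * (p * b) + x * y) b+x≡ma a+y≡mb ⟩
    a * (m * a) + b * (m * b) + 2 * ((m * a) * b) + x * y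
      ≡⟨ solve (m ∷ a ∷ b ∷ x ∷ y ∷ []) ⟩
    m * ((a + b) * (a + b)) + x * y
      ∎
    where open ≡-Reasoning

  m≤n⇒m≤n*o : ∀ {m n o} → 1 ≤ o → m ≤ n → m ≤ n * o
  m≤n⇒m≤n*o {m} {n} {o} 1≤o m≤n =
    ℕ.≤-trans m≤n (subst (_≤ n * o) (ℕ.*-identityʳ n) (ℕ.*-monoʳ-≤ n 1≤o))

  b≡m*a⇒a≡1∧b≡m : ∀ {m a b} → 1 ≤ a → 1 ≤ b → b ≤ m → b ≡ m * a → a ≡ 1 × b ≡ m
  b≡m*a⇒a≡1∧b≡m {m} {a} {b} 1≤a 1≤b b≤m b≡ma = a≡1 , b≡m
    where
    instance
      m≢0 : ℕ.NonZero m
      m≢0 = ℕ.>-nonZero (ℕ.≤-trans 1≤b b≤m)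
    a≡1 : a ≡ 1
    a≡1 = ℕ.≤-antisym (ℕ.*-cancelˡ-≤ m (subst₂ _≤_ b≡ma (sym (ℕ.*-identityʳ m)) b≤m)) 1≤a
    b≡m : b ≡ m
    b≡m = trans b≡ma (trans (cong (m *_) a≡1) (ℕ.*-identityʳ m))

  module DegreeBounds {m a b : ℕ} (1≤a : 1 ≤ a) (a≤m : a ≤ m) (1≤b : 1 ≤ b) (b≤m : b ≤ m) where

    gapˡ : ∃ λ x → b + x ≡ m * a
    gapˡ = ℕ.m≤n⇒∃[o]m+o≡n (m≤n⇒m≤n*o 1≤a b≤m)

    gapʳ : ∃ λ y → a + y ≡ m * b
    gapʳ = ℕ.m≤n⇒∃[o]m+o≡n (m≤n⇒m≤n*o 1≤b a≤m)

    cross-identity : a * b * (suc m * suc m) ≡ m * ((a + b) * (a + b)) + proj₁ gapˡ * proj₁ gapʳ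
    cross-identity = cross-gap-identity m a b _ _ (proj₂ gapˡ) (proj₂ gapʳ)

    star-edge-≤ : m * ((a + b) * (a + b)) ≤ a * b * (suc m * suc m)
    star-edge-≤ = subst (m * ((a + b) * (a + b)) ≤_) (sym cross-identity) (ℕ.m≤m+n _ _)

    gap-product≡0 : m * ((a + b) * (a + b)) ≡ a * b * (suc m * suc m) → proj₁ gapˡ * proj₁ gapʳ ≡ 0
    gap-product≡0 eq = ℕ.+-cancelˡ-≡ (m * ((a + b) * (a + b))) _ _
                         (trans (sym cross-identity) (trans (sym eq) (sym (ℕ.+-identityʳ _))))

    star-edge-≡⇒ : m * ((a + b) * (a + b)) ≡ a * b * (suc m * suc m) → StarDegrees m a b
    star-edge-≡⇒ eq with ℕ.m*n≡0⇒m≡0∨n≡0 (proj₁ gapˡ) (gap-product≡0 eq)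
    ... | inj₁ x≡0 = inj₁ (b≡m*a⇒a≡1∧b≡m 1≤a 1≤b b≤m
                             (trans (sym (ℕ.+-identityʳ b)) (subst (λ x → b + x ≡ m * a) x≡0 (proj₂ gapˡ))))
    ... | inj₂ y≡0 = StarDegrees-sym (inj₁ (b≡m*a⇒a≡1∧b≡m 1≤b 1≤a a≤m
                             (trans (sym (ℕ.+-identityʳ a)) (subst (λ y → a + y ≡ m * b) y≡0 (proj₂ gapʳ)))))

  star-edge-≡⇐ : ∀ {m a b} → StarDegrees m a b → m * ((a + b) * (a + b)) ≡ a * b * (suc m * suc m)
  star-edge-≡⇐ {m} (inj₁ (refl , refl)) = solve (m ∷ [])
  star-edge-≡⇐ {m} (inj₂ (refl , refl)) = solve (m ∷ [])

open StarEdgeArithmetic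

module Counting where
  open import Data.Nat using (_+_; _≤_; s≤s; z≤n)
  open import Algebra.Properties.CommutativeSemigroup ℕ.+-commutativeSemigroup using (x∙yz≈y∙xz)

  foldFin : {A : Set} → (A → A → A) → A → (n : ℕ) → (Fin n → A) → A
  foldFin _⊕_ e zero    f = e
  foldFin _⊕_ e (suc n) f = f zero ⊕ foldFin _⊕_ e n (f ∘ suc)

  foldr-tabulate : ∀ {A B : Set} (_⊕_ : A → A → A) e n (f : B → A) (g : Fin n → B) →
                   foldr (λ i acc → f i ⊕ acc) e (tabulate g) ≡ foldFin _⊕_ e n (f ∘ g)
  foldr-tabulate _⊕_ e zero    f g = refl
  foldr-tabulate _⊕_ e (suc n) f g = cong (f (g zero) ⊕_) (foldr-tabulate _⊕_ e n f (g ∘ suc))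

  sumFin≡foldFin : ∀ {A : Set} (_⊕_ : A → A → A) e n (f : Fin n → A) →
                   sumFin _⊕_ e n f ≡ foldFin _⊕_ e n f
  sumFin≡foldFin _⊕_ e n f = foldr-tabulate _⊕_ e n f id

  count : (n : ℕ) → (Fin n → Bool) → ℕ
  count n g = foldFin _+_ 0 n (λ j → if g j then 1 else 0)

  count-punchIn : ∀ n (g : Fin (suc n) → Bool) k →
                  count (suc n) g ≡ (if g k then 1 else 0) + count n (g ∘ punchIn k)
  count-punchIn n       g zero    = refl
  count-punchIn (suc n) g (suc k) =
    trans (cong ((if g zero then 1 else 0) +_) (count-punchIn n (g ∘ suc) k))
          (x∙yz≈y∙xz (if g zero then 1 else 0) (if g (suc k) then 1 else 0) _)

  count-≤ : ∀ n g → count n g ≤ n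
  count-≤ zero    g = z≤n
  count-≤ (suc n) g with g zero
  ... | true  = s≤s (count-≤ n (g ∘ suc))
  ... | false = ℕ.m≤n⇒m≤1+n (count-≤ n (g ∘ suc))

  count-all-true : ∀ n g → (∀ j → g j ≡ true) → count n g ≡ n
  count-all-true zero    g all = refl
  count-all-true (suc n) g all rewrite all zero = cong suc (count-all-true n (g ∘ suc) (all ∘ suc))

  count-all-false : ∀ n g → (∀ j → g j ≡ false) → count n g ≡ 0
  count-all-false zero    g none = refl
  count-all-false (suc n) g none rewrite none zero = count-all-false n (g ∘ suc) (none ∘ suc)

  count≡n⇒all-true : ∀ n g → count n g ≡ n → ∀ j → g j ≡ true
  count≡n⇒all-true (suc n) g eq j with g zero in g₀
  count≡n⇒all-true (suc n) g eq zero    | true  = g₀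
  count≡n⇒all-true (suc n) g eq (suc j) | true  = count≡n⇒all-true n (g ∘ suc) (ℕ.suc-injective eq) j
  ...                                   | false = ⊥-elim (ℕ.1+n≰n (subst (_≤ n) eq (count-≤ n (g ∘ suc))))

  count≡0⇒all-false : ∀ n g → count n g ≡ 0 → ∀ j → g j ≡ false
  count≡0⇒all-false (suc n) g eq j with g zero in g₀
  count≡0⇒all-false (suc n) g eq zero    | false = g₀
  count≡0⇒all-false (suc n) g eq (suc j) | false = count≡0⇒all-false n (g ∘ suc) eq j

open Counting

module StarGraphs where
  open import Data.Nat using (_+_; _≤_; s≤s; z≤n)

  degree≡count : ∀ {n} (G : Graph n) i → degree G i ≡ count n (adj G i)
  degree≡count {n} G i = sumFin≡foldFin _+_ 0 n _

  degree-punchIn : ∀ {n} (G : Graph (suc n)) i k →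
                   degree G i ≡ (if adj G i k then 1 else 0) + count n (adj G i ∘ punchIn k)
  degree-punchIn G i k = trans (degree≡count G i) (count-punchIn _ (adj G i) k)

  degree-punchIn-self : ∀ {n} (G : Graph (suc n)) i → degree G i ≡ count n (adj G i ∘ punchIn i)
  degree-punchIn-self {n} G i =
    trans (degree-punchIn G i i)
          (cong (λ b → (if b then 1 else 0) + count n (adj G i ∘ punchIn i)) (adj-irr G i))

  degree-≤ : ∀ {n} (G : Graph (suc n)) i → degree G i ≤ n
  degree-≤ {n} G i = subst (_≤ n) (sym (degree-punchIn-self G i)) (count-≤ n _)

  adj⇒1≤degree : ∀ {n} (G : Graph n) {i j} → adj G i j ≡ true → 1 ≤ degree G i
  adj⇒1≤degree {suc n} G {i} {j} i~j rewrite degree-punchIn G i j | i~j = s≤s z≤n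

  full-degree⇒adj : ∀ {n} (G : Graph (suc n)) {c j} → degree G c ≡ n → c ≢ j → adj G c j ≡ true
  full-degree⇒adj {n} G {c} deg c≢j =
    subst (λ k → adj G c k ≡ true) (Fin.punchIn-punchOut c≢j)
          (count≡n⇒all-true n _ (trans (sym (degree-punchIn-self G c)) deg) (punchOut c≢j))

  leaf⇒unique-neighbour : ∀ {n} (G : Graph (suc n)) {i c j} →
                          degree G i ≡ 1 → adj G i c ≡ true → c ≢ j → adj G i j ≡ false
  leaf⇒unique-neighbour {n} G {i} {c} deg i~c c≢j =
    subst (λ k → adj G i k ≡ false) (Fin.punchIn-punchOut c≢j)
          (count≡0⇒all-false n _ (ℕ.suc-injective others) (punchOut c≢j))
    where
    others : suc (count n (adj G i ∘ punchIn c)) ≡ 1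
    others = trans (cong (λ b → (if b then 1 else 0) + count n (adj G i ∘ punchIn c)) (sym i~c))
                   (trans (sym (degree-punchIn G i c)) deg)

  IsStarCentredAt : ∀ {n} → Graph n → Fin n → Set
  IsStarCentredAt G c = ∀ i j → adj G i j ≡ (does (i ≟ c) xor does (j ≟ c))

  isZero-injection : ∀ {m n} (σ : Fin m → Fin (suc n)) → Injective _≡_ _≡_ σ →
                     ∀ {c} → σ c ≡ zero → ∀ y → isZero (σ y) ≡ does (y ≟ c)
  isZero-injection σ σ-inj {c} σc≡0 y with y ≟ c
  ... | yes refl = cong isZero σc≡0
  ... | no y≢c with σ y in σy
  ...   | zero  = ⊥-elim (y≢c (σ-inj (trans σy (sym σc≡0))))
  ...   | suc _ = refl

  centred⇒≅star : ∀ {n} (G : Graph (suc n)) {c} → IsStarCentredAt G c → G ≅ star (suc n)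
  centred⇒≅star G {c} centred = transpose c zero , λ i j →
    trans (centred i j) (sym (cong₂ _xor_ (isZero-transpose i) (isZero-transpose j)))
    where
    transpose-c : PC.transpose c zero c ≡ zero
    transpose-c rewrite dec-true (c ≟ c) refl = refl
    isZero-transpose : ∀ y → isZero (PC.transpose c zero y) ≡ does (y ≟ c)
    isZero-transpose = isZero-injection _ (Injection.injective (↔⇒↣ (transpose c zero))) transpose-c

  ≅star⇒centred : ∀ {n} (G : Graph (suc n)) → G ≅ star (suc n) → ∃ (IsStarCentredAt G)
  ≅star⇒centred G (σ , σ-adj) = Inverse.from σ zero , λ i j →
    trans (σ-adj i j) (cong₂ _xor_ (isZero-σ i) (isZero-σ j))
    where
    isZero-σ : ∀ y → isZero (Inverse.to σ y) ≡ does (y ≟ Inverse.from σ zero)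
    isZero-σ = isZero-injection _ (Injection.injective (↔⇒↣ σ)) (Inverse.strictlyInverseˡ σ zero)

  module StarCentredAt {n} {G : Graph (suc n)} {c} (centred : IsStarCentredAt G c) where

    centre-adj : ∀ {j} → j ≢ c → adj G c j ≡ true
    centre-adj {j} j≢c rewrite centred c j | dec-true (c ≟ c) refl | dec-false (j ≟ c) j≢c = refl

    leaf-adj : ∀ {i j} → i ≢ c → j ≢ c → adj G i j ≡ false
    leaf-adj {i} {j} i≢c j≢c rewrite centred i j | dec-false (i ≟ c) i≢c | dec-false (j ≟ c) j≢c = refl

    centre-degree : degree G c ≡ n
    centre-degree = trans (degree-punchIn-self G c) (count-all-true n _ (centre-adj ∘ Fin.punchInᵢ≢i c))

    leaf-degree : ∀ {i} → i ≢ c → degree G i ≡ 1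
    leaf-degree {i} i≢c =
      trans (degree-punchIn G i c)
            (cong₂ (λ b r → (if b then 1 else 0) + r)
                   (trans (adj-sym G i c) (centre-adj i≢c))
                   (count-all-false n _ (leaf-adj i≢c ∘ Fin.punchInᵢ≢i c)))

    edge-StarDegrees : ∀ {i j} → adj G i j ≡ true → StarDegrees n (degree G i) (degree G j)
    edge-StarDegrees {i} {j} i~j with i ≟ c | j ≟ c
    ... | yes refl | yes refl with () ← trans (sym i~j) (adj-irr G i)
    ... | yes refl | no j≢c   = inj₂ (centre-degree , leaf-degree j≢c)
    ... | no i≢c   | yes refl = inj₁ (leaf-degree i≢c , centre-degree)
    ... | no i≢c   | no j≢c   with () ← trans (sym i~j) (leaf-adj i≢c j≢c)

  module ConnectedStarDegrees {k} {G : Graph (suc (suc k))} (connected : Connected G)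
    (star-edges : ∀ {i j} → adj G i j ≡ true → StarDegrees (suc k) (degree G i) (degree G j)) where

    centre : ∃ λ c → degree G c ≡ suc k
    centre with connected zero (suc zero)
    ... | step {k = v} 0~v _ with star-edges 0~v
    ...   | inj₁ (_ , deg-v) = v , deg-v
    ...   | inj₂ (deg-0 , _) = zero , deg-0

    c = proj₁ centre

    centre-adj : ∀ {j} → j ≢ c → adj G c j ≡ true
    centre-adj j≢c = full-degree⇒adj G (proj₂ centre) (j≢c ∘ sym)

    leaf-nonadj : ∀ {i j} → degree G i ≡ 1 → i ≢ c → j ≢ c → adj G i j ≡ false
    leaf-nonadj {i} deg-i i≢c j≢c =
      leaf⇒unique-neighbour G deg-i (trans (adj-sym G i c) (centre-adj i≢c)) (j≢c ∘ sym)

    leaf-adj : ∀ {i j} → i ≢ c → j ≢ c → adj G i j ≡ false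
    leaf-adj {i} {j} i≢c j≢c with adj G i j in i~j
    ... | false = refl
    ... | true with star-edges i~j
    ...   | inj₁ (deg-i , _) = trans (sym i~j) (leaf-nonadj deg-i i≢c j≢c)
    ...   | inj₂ (_ , deg-j) = trans (sym i~j) (trans (adj-sym G i j) (leaf-nonadj deg-j j≢c i≢c))

    centred : IsStarCentredAt G c
    centred i j with i ≟ c | j ≟ c
    ... | yes refl | yes refl = adj-irr G i
    ... | yes refl | no j≢c   = centre-adj j≢c
    ... | no i≢c   | yes refl = trans (adj-sym G i c) (centre-adj i≢c)
    ... | no i≢c   | no j≢c   = leaf-adj i≢c j≢c

  edges-wlog-ordered : ∀ {n} (G : Graph n) (P : Fin n → Fin n → Set) → (∀ {i j} → P i j → P j i) →
                       (∀ {i j} → toℕ i ℕ.< toℕ j → adj G i j ≡ true → P i j) →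
                       ∀ {i j} → adj G i j ≡ true → P i j
  edges-wlog-ordered G P P-sym P-ordered {i} {j} i~j with ℕ.<-cmp (toℕ i) (toℕ j)
  ... | tri< i<j _ _ = P-ordered i<j i~j
  ... | tri> _ _ j<i = P-sym (P-ordered j<i (trans (adj-sym G j i) i~j))
  ... | tri≈ _ i≡j _ with refl ← Fin.toℕ-injective i≡j with () ← trans (sym i~j) (adj-irr G i)

open StarGraphs

module RealFieldProperties (R : RealField) where
  open RealField R renaming (+-mono-≤ to +-monoˡ-≤; _≤_ to infix 4 _≤_)
  open Indices R using (fromℕ; _/_)

  commutativeRing : CommutativeRing 0ℓ 0ℓ
  commutativeRing = record { isCommutativeRing = isCommutativeRing }

  open CommutativeRing commutativeRing
    using ( +-comm; +-identityˡ; +-identityʳ; -‿inverseʳ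
          ; *-assoc; *-comm; *-identityˡ; *-identityʳ; zeroˡ; zeroʳ; distribˡ
          ; +-group; semiring; commutativeSemiring )
  open IsTotalOrder isTotalOrder
    using (total) renaming (refl to ≤-refl; reflexive to ≤-reflexive; trans to ≤-trans; antisym to ≤-antisym)
  open import Algebra.Properties.Group +-group using (//-rightDividesˡ; //-rightDividesʳ)
  open import Algebra.Properties.Semiring.Mult semiring using (×-homo-+; ×1-homo-*) renaming (_×_ to _×ₙ_)
  open import Algebra.Solver.Ring.NaturalCoefficients.Default commutativeSemiring
    using (solve; _:=_; _:+_; _:*_; con)

  +-monoʳ-≤ : ∀ z {x y} → x ≤ y → z + x ≤ z + y
  +-monoʳ-≤ z {x} {y} x≤y = subst₂ _≤_ (+-comm x z) (+-comm y z) (+-monoˡ-≤ x y z x≤y)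

  +-mono-≤ : ∀ {x y u v} → x ≤ y → u ≤ v → x + u ≤ y + v
  +-mono-≤ {x} {y} {u} x≤y u≤v = ≤-trans (+-monoˡ-≤ x y u x≤y) (+-monoʳ-≤ y u≤v)

  +-nonneg : ∀ {x y} → 0r ≤ x → 0r ≤ y → 0r ≤ x + y
  +-nonneg 0≤x 0≤y = subst (_≤ _) (+-identityˡ 0r) (+-mono-≤ 0≤x 0≤y)

  x≤x+nonneg : ∀ x {d} → 0r ≤ d → x ≤ x + d
  x≤x+nonneg x {d} 0≤d = subst (_≤ x + d) (+-identityʳ x) (+-monoʳ-≤ x 0≤d)

  +-cancelʳ-≡ : ∀ z {x y} → x + z ≡ y + z → x ≡ y
  +-cancelʳ-≡ z {x} {y} eq =
    trans (sym (//-rightDividesʳ z x)) (trans (cong (_+ - z) eq) (//-rightDividesʳ z y))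

  +-cancelˡ-≤ : ∀ z {x y} → z + x ≤ z + y → x ≤ y
  +-cancelˡ-≤ z {x} {y} z+x≤z+y =
    subst₂ _≤_ (//-rightDividesʳ z x) (//-rightDividesʳ z y)
           (+-monoˡ-≤ _ _ (- z) (subst₂ _≤_ (+-comm z x) (+-comm z y) z+x≤z+y))

  +-cancelˡ-≡ : ∀ z {x y} → z + x ≡ z + y → x ≡ y
  +-cancelˡ-≡ z {x} {y} eq = +-cancelʳ-≡ z (trans (+-comm x z) (trans eq (+-comm z y)))

  ≤⇒nonneg-difference : ∀ {x y} → x ≤ y → ∃ λ d → 0r ≤ d × y ≡ x + d
  ≤⇒nonneg-difference {x} {y} x≤y =
    y + - x , subst (_≤ y + - x) (-‿inverseʳ x) (+-monoˡ-≤ x y (- x) x≤y)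
            , trans (sym (//-rightDividesˡ x y)) (+-comm _ x)

  0≤1 : 0r ≤ 1r
  0≤1 with total 0r 1r
  ... | inj₁ 0≤1 = 0≤1
  ... | inj₂ 1≤0 with ≤⇒nonneg-difference 1≤0
  ...   | d , 0≤d , 0≡1+d = subst (0r ≤_) d*d≡1 (*-nonneg d d 0≤d 0≤d)
    where
    -- d is −1
    d*d≡1 : d * d ≡ 1r
    d*d≡1 = +-cancelʳ-≡ d (begin
      d * d + d     ≡⟨ solve 1 (λ d → d :* d :+ d := d :* (con 1 :+ d)) refl d ⟩
      d * (1r + d)  ≡⟨ cong (d *_) 0≡1+d ⟨
      d * 0r        ≡⟨ zeroʳ d ⟩
      0r            ≡⟨ 0≡1+d ⟩
      1r + d        ∎)
      where open ≡-Reasoning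

  1≰0 : ¬ (1r ≤ 0r)
  1≰0 1≤0 = 0≢1 (≤-antisym 0≤1 1≤0)

  1+nonneg≢0 : ∀ {x} → 0r ≤ x → 1r + x ≢ 0r
  1+nonneg≢0 0≤x eq = 1≰0 (subst (1r ≤_) eq (x≤x+nonneg 1r 0≤x))

  two : Carrier
  two = 1r + 1r

  0≤two : 0r ≤ two
  0≤two = +-nonneg 0≤1 0≤1

  two≢0 : two ≢ 0r
  two≢0 = 1+nonneg≢0 0≤1

  *-monoʳ-≤-nonneg : ∀ {z x y} → 0r ≤ z → x ≤ y → z * x ≤ z * y
  *-monoʳ-≤-nonneg {z} {x} 0≤z x≤y with ≤⇒nonneg-difference x≤y
  ... | d , 0≤d , refl =
    subst (z * x ≤_) (sym (distribˡ z x d)) (x≤x+nonneg (z * x) (*-nonneg z d 0≤z 0≤d))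

  ⁻¹-cancelˡ : ∀ {w} → w ≢ 0r → ∀ x → w ⁻¹ * (w * x) ≡ x
  ⁻¹-cancelˡ {w} w≢0 x = begin
    w ⁻¹ * (w * x)  ≡⟨ *-assoc _ _ _ ⟨
    w ⁻¹ * w * x    ≡⟨ cong (_* x) (trans (*-comm _ _) (inverseʳ w w≢0)) ⟩
    1r * x          ≡⟨ *-identityˡ x ⟩
    x               ∎
    where open ≡-Reasoning

  *-cancelˡ-≡ : ∀ {w x y} → w ≢ 0r → w * x ≡ w * y → x ≡ y
  *-cancelˡ-≡ {w} {x} {y} w≢0 eq =
    trans (sym (⁻¹-cancelˡ w≢0 x)) (trans (cong (w ⁻¹ *_) eq) (⁻¹-cancelˡ w≢0 y))

  *-≢0 : ∀ {x y} → x ≢ 0r → y ≢ 0r → x * y ≢ 0r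
  *-≢0 {x} x≢0 y≢0 xy≡0 = y≢0 (*-cancelˡ-≡ x≢0 (trans xy≡0 (sym (zeroʳ x))))

  ⁻¹-nonneg : ∀ {x} → 0r ≤ x → x ≢ 0r → 0r ≤ x ⁻¹
  ⁻¹-nonneg {x} 0≤x x≢0 with total 0r (x ⁻¹)
  ... | inj₁ 0≤x⁻¹ = 0≤x⁻¹
  ... | inj₂ x⁻¹≤0 with ≤⇒nonneg-difference x⁻¹≤0
  ...   | d , 0≤d , 0≡x⁻¹+d =
    ⊥-elim (1≰0 (subst (1r ≤_) 1+xd≡0 (x≤x+nonneg 1r (*-nonneg x d 0≤x 0≤d))))
    where
    1+xd≡0 : 1r + x * d ≡ 0r
    1+xd≡0 = begin
      1r + x * d          ≡⟨ cong (_+ x * d) (inverseʳ x x≢0) ⟨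
      x * x ⁻¹ + x * d    ≡⟨ distribˡ x _ d ⟨
      x * (x ⁻¹ + d)      ≡⟨ cong (x *_) 0≡x⁻¹+d ⟨
      x * 0r              ≡⟨ zeroʳ x ⟩
      0r                  ∎
      where open ≡-Reasoning

  *-cancelˡ-≤-pos : ∀ {w x y} → 0r ≤ w → w ≢ 0r → w * x ≤ w * y → x ≤ y
  *-cancelˡ-≤-pos {w} {x} {y} 0≤w w≢0 wx≤wy =
    subst₂ _≤_ (⁻¹-cancelˡ w≢0 x) (⁻¹-cancelˡ w≢0 y) (*-monoʳ-≤-nonneg (⁻¹-nonneg 0≤w w≢0) wx≤wy)

  fromℕ≡×1 : ∀ n → fromℕ n ≡ n ×ₙ 1r
  fromℕ≡×1 zero    = refl
  fromℕ≡×1 (suc n) = cong (1r +_) (fromℕ≡×1 n)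

  fromℕ-+ : ∀ m n → fromℕ (m ℕ.+ n) ≡ fromℕ m + fromℕ n
  fromℕ-+ m n =
    trans (fromℕ≡×1 (m ℕ.+ n)) (trans (×-homo-+ 1r m n) (sym (cong₂ _+_ (fromℕ≡×1 m) (fromℕ≡×1 n))))

  fromℕ-* : ∀ m n → fromℕ (m ℕ.* n) ≡ fromℕ m * fromℕ n
  fromℕ-* m n =
    trans (fromℕ≡×1 (m ℕ.* n)) (trans (×1-homo-* m n) (sym (cong₂ _*_ (fromℕ≡×1 m) (fromℕ≡×1 n))))

  fromℕ-nonneg : ∀ n → 0r ≤ fromℕ n
  fromℕ-nonneg zero    = ≤-refl
  fromℕ-nonneg (suc n) = +-nonneg 0≤1 (fromℕ-nonneg n)

  fromℕ-suc≢0 : ∀ n → fromℕ (suc n) ≢ 0r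
  fromℕ-suc≢0 n = 1+nonneg≢0 (fromℕ-nonneg n)

  fromℕ-≢0 : ∀ {n} → 1 ℕ.≤ n → fromℕ n ≢ 0r
  fromℕ-≢0 {suc n} _ = fromℕ-suc≢0 n

  fromℕ-mono-≤ : ∀ {m n} → m ℕ.≤ n → fromℕ m ≤ fromℕ n
  fromℕ-mono-≤ {m} m≤n with ℕ.m≤n⇒∃[o]m+o≡n m≤n
  ... | o , refl = subst (fromℕ m ≤_) (sym (fromℕ-+ m o)) (x≤x+nonneg (fromℕ m) (fromℕ-nonneg o))

  fromℕ-injective : ∀ {m n} → fromℕ m ≡ fromℕ n → m ≡ n
  fromℕ-injective {zero}  {zero}  _  = refl
  fromℕ-injective {zero}  {suc n} eq = ⊥-elim (fromℕ-suc≢0 n (sym eq))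
  fromℕ-injective {suc m} {zero}  eq = ⊥-elim (fromℕ-suc≢0 m eq)
  fromℕ-injective {suc m} {suc n} eq = cong suc (fromℕ-injective (+-cancelˡ-≡ 1r eq))

  -- Equality of reals is not decidable, so we cannot divide by d.  Instead, the nonnegative
  -- square-zero elements are closed under doubling, so their supremum s satisfies s ≤ s/2.
  square≡0⇒≡0 : ∀ {d} → 0r ≤ d → d * d ≡ 0r → d ≡ 0r
  square≡0⇒≡0 {d} 0≤d dd≡0 = ≤-antisym (≤-trans (upper d (0≤d , dd≡0)) s≤0) 0≤d
    where
    SquareZero : Carrier → Set
    SquareZero x = 0r ≤ x × x * x ≡ 0r

    ≤1 : ∀ x → SquareZero x → x ≤ 1r
    ≤1 x (0≤x , xx≡0) with total x 1r
    ... | inj₁ x≤1 = x≤1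
    ... | inj₂ 1≤x = ≤-trans (subst₂ _≤_ (*-identityʳ x) xx≡0 (*-monoʳ-≤-nonneg 0≤x 1≤x)) 0≤1

    supremum = sup SquareZero (0r , ≤-refl , zeroˡ 0r) (1r , ≤1)
    s = proj₁ supremum
    upper = proj₁ (proj₂ supremum)
    least = proj₂ (proj₂ supremum)

    doubled : ∀ x → SquareZero x → SquareZero (two * x)
    doubled x (0≤x , xx≡0) = *-nonneg two x 0≤two 0≤x , (begin
      (two * x) * (two * x)  ≡⟨ solve 2 (λ t x → (t :* x) :* (t :* x) := (t :* t) :* (x :* x)) refl two x ⟩
      (two * two) * (x * x)  ≡⟨ cong ((two * two) *_) xx≡0 ⟩
      (two * two) * 0r       ≡⟨ zeroʳ _ ⟩
      0r                     ∎)
      where open ≡-Reasoning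

    s≤s/2 : s ≤ two ⁻¹ * s
    s≤s/2 = least _ λ x sqx →
      subst (_≤ two ⁻¹ * s) (⁻¹-cancelˡ two≢0 x)
            (*-monoʳ-≤-nonneg (⁻¹-nonneg 0≤two two≢0) (upper _ (doubled x sqx)))

    s≤0 : s ≤ 0r
    s≤0 = +-cancelˡ-≤ s (subst₂ _≤_ s+s≡2s (sym 2[s/2]≡s+0) (*-monoʳ-≤-nonneg 0≤two s≤s/2))
      where
      s+s≡2s : two * s ≡ s + s
      s+s≡2s = solve 1 (λ s → con 2 :* s := s :+ s) refl s
      2[s/2]≡s+0 : s + 0r ≡ two * (two ⁻¹ * s)
      2[s/2]≡s+0 = trans (+-identityʳ s)
        (sym (trans (sym (*-assoc two _ s)) (trans (cong (_* s) (inverseʳ two two≢0)) (*-identityˡ s))))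

  square-injective-≤ : ∀ {x y} → 0r ≤ x → x ≤ y → x * x ≡ y * y → x ≡ y
  square-injective-≤ {x} 0≤x x≤y sq with ≤⇒nonneg-difference x≤y
  ... | d , 0≤d , refl = sym (trans (cong (x +_) d≡0) (+-identityʳ x))
    where
    cross : x * x + ((x + x) * d + d * d) ≡ x * x + 0r
    cross = trans (solve 2 (λ x d → x :* x :+ ((x :+ x) :* d :+ d :* d) := (x :+ d) :* (x :+ d)) refl x d)
                  (trans (sym sq) (sym (+-identityʳ (x * x))))
    dd≤0 : d * d ≤ 0r
    dd≤0 = subst (d * d ≤_) (trans (+-comm _ _) (+-cancelˡ-≡ (x * x) cross))
                  (x≤x+nonneg (d * d) (*-nonneg _ d (+-nonneg 0≤x 0≤x) 0≤d))
    d≡0 : d ≡ 0r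
    d≡0 = square≡0⇒≡0 0≤d (≤-antisym dd≤0 (*-nonneg d d 0≤d 0≤d))

  square-injective : ∀ {x y} → 0r ≤ x → 0r ≤ y → x * x ≡ y * y → x ≡ y
  square-injective {x} {y} 0≤x 0≤y sq with total x y
  ... | inj₁ x≤y = square-injective-≤ 0≤x x≤y sq
  ... | inj₂ y≤x = sym (square-injective-≤ 0≤y y≤x (sym sq))

  √-quotient : ∀ {x y} → 0r ≤ x → 0r ≤ y → y ≢ 0r → √ (x / y) * y ≡ √ (x * y)
  √-quotient {x} {y} 0≤x 0≤y y≢0 =
    square-injective (*-nonneg _ y (√-nonneg _ 0≤x/y) 0≤y) (√-nonneg _ 0≤xy) (begin
    (r * y) * (r * y)        ≡⟨ solve 2 (λ r y → (r :* y) :* (r :* y) := (r :* r) :* (y :* y)) refl r y ⟩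
    (r * r) * (y * y)        ≡⟨ cong (_* (y * y)) (√-sq _ 0≤x/y) ⟩
    (x * y ⁻¹) * (y * y)
      ≡⟨ solve 3 (λ x y⁻¹ y → (x :* y⁻¹) :* (y :* y) := (x :* y) :* (y :* y⁻¹)) refl x (y ⁻¹) y ⟩
    (x * y) * (y * y ⁻¹)     ≡⟨ cong ((x * y) *_) (inverseʳ y y≢0) ⟩
    (x * y) * 1r             ≡⟨ *-identityʳ _ ⟩
    x * y                    ≡⟨ √-sq _ 0≤xy ⟨
    √ (x * y) * √ (x * y)    ∎)
    where
    open ≡-Reasoning
    r = √ (x / y)
    0≤x/y = *-nonneg x _ 0≤x (⁻¹-nonneg 0≤y y≢0)
    0≤xy = *-nonneg x y 0≤x 0≤y

  ∑ : (n : ℕ) → (Fin n → Carrier) → Carrier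
  ∑ = foldFin _+_ 0r

  ∑-cong : ∀ n {f g} → (∀ i → f i ≡ g i) → ∑ n f ≡ ∑ n g
  ∑-cong zero    f≗g = refl
  ∑-cong (suc n) f≗g = cong₂ _+_ (f≗g zero) (∑-cong n (f≗g ∘ suc))

  ∑-mono-≤ : ∀ n {f g} → (∀ i → f i ≤ g i) → ∑ n f ≤ ∑ n g
  ∑-mono-≤ zero    f≤g = ≤-refl
  ∑-mono-≤ (suc n) f≤g = +-mono-≤ (f≤g zero) (∑-mono-≤ n (f≤g ∘ suc))

  *-distribˡ-∑ : ∀ n c f → c * ∑ n f ≡ ∑ n (λ i → c * f i)
  *-distribˡ-∑ zero    c f = zeroʳ c
  *-distribˡ-∑ (suc n) c f = trans (distribˡ c _ _) (cong (c * f zero +_) (*-distribˡ-∑ n c (f ∘ suc)))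

  ∑-mono-≤-equality : ∀ n {f g} → (∀ i → f i ≤ g i) → ∑ n f ≡ ∑ n g → ∀ i → f i ≡ g i
  ∑-mono-≤-equality (suc n) {f} {g} f≤g eq = λ where
      zero    → head-eq
      (suc i) → ∑-mono-≤-equality n (f≤g ∘ suc) tail-eq i
    where
    tail-≤ : ∑ n (f ∘ suc) ≤ ∑ n (g ∘ suc)
    tail-≤ = ∑-mono-≤ n (f≤g ∘ suc)
    same-head : f zero + ∑ n (f ∘ suc) ≡ f zero + ∑ n (g ∘ suc)
    same-head = ≤-antisym (+-monoʳ-≤ (f zero) tail-≤)
                          (≤-trans (+-monoˡ-≤ _ _ _ (f≤g zero)) (≤-reflexive (sym eq)))
    tail-eq : ∑ n (f ∘ suc) ≡ ∑ n (g ∘ suc)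
    tail-eq = +-cancelˡ-≡ (f zero) same-head
    head-eq : f zero ≡ g zero
    head-eq = +-cancelʳ-≡ (∑ n (g ∘ suc)) (trans (sym same-head) eq)

  module EdgeSums {n} (G : Graph n) where
    open Indices R using (edgeSum)

    edgeTerm : (Fin n → Fin n → Carrier) → Fin n → Fin n → Carrier
    edgeTerm f i j = if (toℕ i ℕ.<ᵇ toℕ j) ∧ adj G i j then f i j else 0r

    edgeSum≡∑∑ : ∀ f → edgeSum G f ≡ ∑ n (λ i → ∑ n (edgeTerm f i))
    edgeSum≡∑∑ f = trans (sumFin≡foldFin _+_ 0r n _) (∑-cong n (λ i → sumFin≡foldFin _+_ 0r n _))

    edgeTerm-mono-≤ : ∀ {f g} → (∀ {i j} → adj G i j ≡ true → f i j ≤ g i j) →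
                      ∀ i j → edgeTerm f i j ≤ edgeTerm g i j
    edgeTerm-mono-≤ f≤g i j with toℕ i ℕ.<ᵇ toℕ j
    ... | false = ≤-refl
    ... | true with adj G i j in i~j
    ...   | true  = f≤g i~j
    ...   | false = ≤-refl

    edgeSum-mono-≤ : ∀ {f g} → (∀ {i j} → adj G i j ≡ true → f i j ≤ g i j) →
                     edgeSum G f ≤ edgeSum G g
    edgeSum-mono-≤ {f} {g} f≤g =
      subst₂ _≤_ (sym (edgeSum≡∑∑ f)) (sym (edgeSum≡∑∑ g))
                 (∑-mono-≤ n λ i → ∑-mono-≤ n (edgeTerm-mono-≤ f≤g i))

    edgeSum-cong : ∀ {f g} → (∀ {i j} → adj G i j ≡ true → f i j ≡ g i j) →
                   edgeSum G f ≡ edgeSum G g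
    edgeSum-cong f≡g =
      ≤-antisym (edgeSum-mono-≤ (≤-reflexive ∘ f≡g)) (edgeSum-mono-≤ (≤-reflexive ∘ sym ∘ f≡g))

    *-distribˡ-edgeTerm : ∀ c f i j → c * edgeTerm f i j ≡ edgeTerm (λ i j → c * f i j) i j
    *-distribˡ-edgeTerm c f i j with (toℕ i ℕ.<ᵇ toℕ j) ∧ adj G i j
    ... | true  = refl
    ... | false = zeroʳ c

    *-distribˡ-edgeSum : ∀ c f → c * edgeSum G f ≡ edgeSum G (λ i j → c * f i j)
    *-distribˡ-edgeSum c f = begin
      c * edgeSum G f
        ≡⟨ cong (c *_) (edgeSum≡∑∑ f) ⟩
      c * ∑ n (λ i → ∑ n (edgeTerm f i))
        ≡⟨ *-distribˡ-∑ n c _ ⟩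
      ∑ n (λ i → c * ∑ n (edgeTerm f i))
        ≡⟨ ∑-cong n (λ i → *-distribˡ-∑ n c _) ⟩
      ∑ n (λ i → ∑ n (λ j → c * edgeTerm f i j))
        ≡⟨ ∑-cong n (λ i → ∑-cong n (*-distribˡ-edgeTerm c f i)) ⟩
      ∑ n (λ i → ∑ n (edgeTerm (λ i j → c * f i j) i))
        ≡⟨ edgeSum≡∑∑ _ ⟨
      edgeSum G (λ i j → c * f i j)
        ∎
      where open ≡-Reasoning

    edgeSum-mono-≤-equality : ∀ {f g} → (∀ {i j} → adj G i j ≡ true → f i j ≤ g i j) →
                              edgeSum G f ≡ edgeSum G g →
                              ∀ {i j} → toℕ i ℕ.< toℕ j → adj G i j ≡ true → f i j ≡ g i j
    edgeSum-mono-≤-equality {f} {g} f≤g eq {i} {j} i<j i~j = on-edge termwise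
      where
      termwise : edgeTerm f i j ≡ edgeTerm g i j
      termwise = ∑-mono-≤-equality n (edgeTerm-mono-≤ f≤g i)
                   (∑-mono-≤-equality n (λ i → ∑-mono-≤ n (edgeTerm-mono-≤ f≤g i))
                      (trans (sym (edgeSum≡∑∑ f)) (trans eq (edgeSum≡∑∑ g))) i) j
      on-edge : edgeTerm f i j ≡ edgeTerm g i j → f i j ≡ g i j
      on-edge eq′ rewrite i~j with toℕ i ℕ.<ᵇ toℕ j in i<ᵇj
      ... | true  = eq′
      ... | false = ⊥-elim (subst T i<ᵇj (ℕ.<⇒<ᵇ i<j))

  fromℕ-4* : ∀ k → fromℕ (4 ℕ.* k) ≡ two * two * fromℕ k
  fromℕ-4* k =
    trans (fromℕ-* 4 k) (cong (_* fromℕ k) (trans (fromℕ-* 2 2) (cong₂ _*_ fromℕ-2 fromℕ-2)))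
    where
    fromℕ-2 : fromℕ 2 ≡ two
    fromℕ-2 = cong (1r +_) (+-identityʳ 1r)

  agTerm : Carrier → Carrier → Carrier
  agTerm x y = (1r / (1r + 1r)) * ((√ (x / y)) + (√ (y / x)))

  gaTerm : Carrier → Carrier → Carrier
  gaTerm x y = ((1r + 1r) * (√ (x * y))) / (x + y)

  starRatio : ℕ → Carrier
  starRatio m = fromℕ (suc m ℕ.* suc m) / fromℕ (4 ℕ.* m)

  module EdgeTerms {a b : ℕ} (1≤a : 1 ℕ.≤ a) (1≤b : 1 ℕ.≤ b) where
    A = fromℕ a
    B = fromℕ b
    u = √ (A * B)

    0≤A : 0r ≤ A
    0≤A = fromℕ-nonneg a
    0≤B : 0r ≤ B
    0≤B = fromℕ-nonneg b
    0≤AB : 0r ≤ A * B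
    0≤AB = *-nonneg A B 0≤A 0≤B
    A+B≢0 : A + B ≢ 0r
    A+B≢0 = subst (_≢ 0r) (fromℕ-+ a b) (fromℕ-≢0 (ℕ.≤-trans 1≤a (ℕ.m≤m+n a b)))
    0≤u : 0r ≤ u
    0≤u = √-nonneg _ 0≤AB
    u≢0 : u ≢ 0r
    u≢0 u≡0 = *-≢0 (fromℕ-≢0 1≤a) (fromℕ-≢0 1≤b) (begin
      A * B  ≡⟨ √-sq _ 0≤AB ⟨
      u * u  ≡⟨ cong (λ x → x * x) u≡0 ⟩
      0r * 0r ≡⟨ zeroˡ 0r ⟩
      0r     ∎)
      where open ≡-Reasoning

    √A/B*B≡u : √ (A / B) * B ≡ u
    √A/B*B≡u = √-quotient 0≤A 0≤B (fromℕ-≢0 1≤b)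

    √B/A*A≡u : √ (B / A) * A ≡ u
    √B/A*A≡u = trans (√-quotient 0≤B 0≤A (fromℕ-≢0 1≤a)) (cong √_ (*-comm B A))

    ag-identity : (two * (A * B)) * agTerm A B ≡ u * (A + B)
    ag-identity = begin
      (two * (A * B)) * agTerm A B
        ≡⟨ solve 6 (λ t h A B p q → (t :* (A :* B)) :* ((con 1 :* h) :* (p :+ q))
                                  := (t :* h) :* ((p :* B) :* A :+ (q :* A) :* B))
                   refl two (two ⁻¹) A B (√ (A / B)) (√ (B / A)) ⟩
      (two * two ⁻¹) * ((√ (A / B) * B) * A + (√ (B / A) * A) * B)
        ≡⟨ cong₂ _*_ (inverseʳ two two≢0) (cong₂ (λ p q → p * A + q * B) √A/B*B≡u √B/A*A≡u) ⟩
      1r * (u * A + u * B)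
        ≡⟨ trans (*-identityˡ _) (sym (distribˡ u A B)) ⟩
      u * (A + B) ∎
      where open ≡-Reasoning

    ga-identity : (A + B) * gaTerm A B ≡ two * u
    ga-identity = begin
      (A + B) * ((two * u) * (A + B) ⁻¹)
        ≡⟨ solve 3 (λ s v s⁻¹ → s :* (v :* s⁻¹) := v :* (s :* s⁻¹)) refl (A + B) (two * u) ((A + B) ⁻¹) ⟩
      (two * u) * ((A + B) * (A + B) ⁻¹)  ≡⟨ cong ((two * u) *_) (inverseʳ (A + B) A+B≢0) ⟩
      (two * u) * 1r                       ≡⟨ *-identityʳ _ ⟩
      two * u                              ∎
      where open ≡-Reasoning

    module DegreesAtMost {m : ℕ} (a≤m : a ℕ.≤ m) (b≤m : b ℕ.≤ m) where
      open DegreeBounds 1≤a a≤m 1≤b b≤m using (star-edge-≤; star-edge-≡⇒)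

      m[a+b]² ab[m+1]² : ℕ
      m[a+b]² = m ℕ.* ((a ℕ.+ b) ℕ.* (a ℕ.+ b))
      ab[m+1]² = a ℕ.* b ℕ.* (suc m ℕ.* suc m)

      N² = fromℕ (suc m ℕ.* suc m)
      4m = fromℕ (4 ℕ.* m)

      4m≢0 : 4m ≢ 0r
      4m≢0 = fromℕ-≢0 (ℕ.≤-trans (ℕ.≤-trans 1≤a a≤m) (ℕ.m≤n*m m 4))

      scale : Carrier
      scale = 4m * (A + B) * (two * (A * B))

      0≤scale : 0r ≤ scale
      0≤scale = *-nonneg _ _ (*-nonneg _ _ (fromℕ-nonneg (4 ℕ.* m)) (+-nonneg 0≤A 0≤B))
                             (*-nonneg _ _ 0≤two 0≤AB)

      scale≢0 : scale ≢ 0r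
      scale≢0 = *-≢0 (*-≢0 4m≢0 A+B≢0) (*-≢0 two≢0 (*-≢0 (fromℕ-≢0 1≤a) (fromℕ-≢0 1≤b)))

      scaled-ag : scale * agTerm A B ≡ u * fromℕ (4 ℕ.* m[a+b]²)
      scaled-ag = begin
        scale * agTerm A B                               ≡⟨ *-assoc _ _ _ ⟩
        4m * (A + B) * ((two * (A * B)) * agTerm A B)    ≡⟨ cong (4m * (A + B) *_) ag-identity ⟩
        4m * (A + B) * (u * (A + B))
          ≡⟨ cong (λ x → x * (A + B) * (u * (A + B))) (fromℕ-4* m) ⟩
        two * two * fromℕ m * (A + B) * (u * (A + B))
          ≡⟨ solve 5 (λ t M A B u → t :* t :* M :* (A :+ B) :* (u :* (A :+ B))
                                 := u :* (t :* t :* (M :* ((A :+ B) :* (A :+ B)))))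
                     refl two (fromℕ m) A B u ⟩
        u * (two * two * (fromℕ m * ((A + B) * (A + B)))) ≡⟨ cong (u *_) fromℕ-lhs ⟨
        u * fromℕ (4 ℕ.* m[a+b]²)                         ∎
        where
        open ≡-Reasoning
        fromℕ-lhs : fromℕ (4 ℕ.* m[a+b]²) ≡ two * two * (fromℕ m * ((A + B) * (A + B)))
        fromℕ-lhs = begin
          fromℕ (4 ℕ.* m[a+b]²)
            ≡⟨ fromℕ-4* m[a+b]² ⟩
          two * two * fromℕ m[a+b]²
            ≡⟨ cong (two * two *_) (fromℕ-* m _) ⟩
          two * two * (fromℕ m * fromℕ ((a ℕ.+ b) ℕ.* (a ℕ.+ b)))
            ≡⟨ cong (λ x → two * two * (fromℕ m * x)) (fromℕ-* (a ℕ.+ b) (a ℕ.+ b)) ⟩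
          two * two * (fromℕ m * (fromℕ (a ℕ.+ b) * fromℕ (a ℕ.+ b)))
            ≡⟨ cong (λ x → two * two * (fromℕ m * (x * x))) (fromℕ-+ a b) ⟩
          two * two * (fromℕ m * ((A + B) * (A + B)))
            ∎

      scaled-ga : scale * (starRatio m * gaTerm A B) ≡ u * fromℕ (4 ℕ.* ab[m+1]²)
      scaled-ga = begin
        scale * ((N² * 4m ⁻¹) * gaTerm A B)
          ≡⟨ solve 7 (λ F F⁻¹ N A B t g → F :* (A :+ B) :* (t :* (A :* B)) :* ((N :* F⁻¹) :* g)
                                         := (F :* F⁻¹) :* (N :* (t :* (A :* B)) :* ((A :+ B) :* g)))
                     refl 4m (4m ⁻¹) N² A B two (gaTerm A B) ⟩
        (4m * 4m ⁻¹) * (N² * (two * (A * B)) * ((A + B) * gaTerm A B))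
          ≡⟨ cong₂ (λ x y → x * (N² * (two * (A * B)) * y)) (inverseʳ 4m 4m≢0) ga-identity ⟩
        1r * (N² * (two * (A * B)) * (two * u))
          ≡⟨ solve 5 (λ N t A B u → con 1 :* (N :* (t :* (A :* B)) :* (t :* u))
                                 := u :* (t :* t :* (A :* B :* N)))
                     refl N² two A B u ⟩
        u * (two * two * (A * B * N²))  ≡⟨ cong (u *_) fromℕ-rhs ⟨
        u * fromℕ (4 ℕ.* ab[m+1]²)      ∎
        where
        open ≡-Reasoning
        fromℕ-rhs : fromℕ (4 ℕ.* ab[m+1]²) ≡ two * two * (A * B * N²)
        fromℕ-rhs = begin
          fromℕ (4 ℕ.* ab[m+1]²)                   ≡⟨ fromℕ-4* ab[m+1]² ⟩
          two * two * fromℕ ab[m+1]²               ≡⟨ cong (two * two *_) (fromℕ-* (a ℕ.* b) _) ⟩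
          two * two * (fromℕ (a ℕ.* b) * N²)
            ≡⟨ cong (λ x → two * two * (x * N²)) (fromℕ-* a b) ⟩
          two * two * (A * B * N²)                 ∎

      agTerm-≤ : agTerm A B ≤ starRatio m * gaTerm A B
      agTerm-≤ = *-cancelˡ-≤-pos 0≤scale scale≢0 (subst₂ _≤_ (sym scaled-ag) (sym scaled-ga)
                   (*-monoʳ-≤-nonneg 0≤u (fromℕ-mono-≤ (ℕ.*-monoʳ-≤ 4 star-edge-≤))))

      agTerm-≡⇒StarDegrees : agTerm A B ≡ starRatio m * gaTerm A B → StarDegrees m a b
      agTerm-≡⇒StarDegrees eq = star-edge-≡⇒ (ℕ.*-cancelˡ-≡ _ _ 4 (fromℕ-injective
        (*-cancelˡ-≡ u≢0 (trans (sym scaled-ag) (trans (cong (scale *_) eq) scaled-ga)))))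

      StarDegrees⇒agTerm-≡ : StarDegrees m a b → agTerm A B ≡ starRatio m * gaTerm A B
      StarDegrees⇒agTerm-≡ star = *-cancelˡ-≡ scale≢0
        (trans scaled-ag (trans (cong (λ k → u * fromℕ (4 ℕ.* k)) (star-edge-≡⇐ star)) (sym scaled-ga)))

open import Data.Nat using (_≤_; _*_; _∸_; s≤s; z≤n)
open import Function.Bundles using (_⇔_; mk⇔)

corollary5 : (R : RealField) → (n : ℕ) → 2 ≤ n → (G : Graph n) → Connected G →
    RealField._≤_ R (Indices.AG R G)
      (RealField._*_ R (Indices._/_ R (Indices.fromℕ R (n * n)) (Indices.fromℕ R (4 * (n ∸ 1)))) (Indices.GA R G))
    × ((Indices.AG R G ≡ RealField._*_ R (Indices._/_ R (Indices.fromℕ R (n * n)) (Indices.fromℕ R (4 * (n ∸ 1)))) (Indices.GA R G))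
        ⇔ (G ≅ star n))
corollary5 R (suc (suc k)) (s≤s (s≤s z≤n)) G connected = AG≤ , mk⇔ equality⇒star star⇒equality
  where
  open RealField R using (Carrier) renaming (_≤_ to infix 4 _≤ᵣ_; _*_ to _*ᵣ_)
  open Indices R using (AG; GA; edgeSum; fromℕ)
  open RealFieldProperties R
  open EdgeSums G

  module Edge {i j} (i~j : adj G i j ≡ true) =
    EdgeTerms.DegreesAtMost (adj⇒1≤degree G i~j) (adj⇒1≤degree G (trans (adj-sym G j i) i~j))
                            (degree-≤ G i) (degree-≤ G j)

  ag ga : Fin (suc (suc k)) → Fin (suc (suc k)) → Carrier
  ag i j = agTerm (fromℕ (degree G i)) (fromℕ (degree G j))
  ga i j = starRatio (suc k) *ᵣ gaTerm (fromℕ (degree G i)) (fromℕ (degree G j))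

  ratio*GA≡ : starRatio (suc k) *ᵣ GA G ≡ edgeSum G ga
  ratio*GA≡ = *-distribˡ-edgeSum (starRatio (suc k)) _

  AG≤ : AG G ≤ᵣ starRatio (suc k) *ᵣ GA G
  AG≤ = subst (AG G ≤ᵣ_) (sym ratio*GA≡) (edgeSum-mono-≤ {ag} {ga} Edge.agTerm-≤)

  equality⇒star : AG G ≡ starRatio (suc k) *ᵣ GA G → G ≅ star (suc (suc k))
  equality⇒star eq = centred⇒≅star G (ConnectedStarDegrees.centred connected star-edges)
    where
    star-edges : ∀ {i j} → adj G i j ≡ true → StarDegrees (suc k) (degree G i) (degree G j)
    star-edges = edges-wlog-ordered G _ StarDegrees-sym λ i<j i~j →
      Edge.agTerm-≡⇒StarDegrees i~j
        (edgeSum-mono-≤-equality {ag} {ga} Edge.agTerm-≤ (trans eq ratio*GA≡) i<j i~j)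

  star⇒equality : G ≅ star (suc (suc k)) → AG G ≡ starRatio (suc k) *ᵣ GA G
  star⇒equality iso =
    trans (edgeSum-cong {ag} {ga} λ i~j → Edge.StarDegrees⇒agTerm-≡ i~j (edge-StarDegrees i~j))
          (sym ratio*GA≡)
    where open StarCentredAt {G = G} (proj₂ (≅star⇒centred G iso)) using (edge-StarDegrees)
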